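{- Let $M$ be a matroid on $[n]$, $I\subseteq[n]$, and $w\in(\mathbb{R}_{\ge0})^n$ with pairwise distinct coordinates; define $u\in\mathbb{R}^n$ by $u_i=w_i$ for $i\in I$ and $u_j=-w_j$ for $j\notin I$. If $M$ has no loops in $I$, then $\sigma=x_Iy_{[n]\setminus I}$ is a face of the external activity complex $B_u(M)$ and the semi-broken circuit complex $\Delta_w(M,I)$ is isomorphic to $\mathrm{link}_{B_u(M)}(\sigma)$ (via $j\mapsto x_j$ for $j\notin I$ and $i\mapsto y_i$ for $i\in I$).
   Context: $w$ orders $[n]$ by $i<j$ iff $w_i<w_j$; for a circuit $C$, $b_I(C)=C\setminus\min_w(C)$ if $C\subseteq I$ and $b_I(C)=(C\cap I)\cup\{\max_w(C\setminus I)\}$ otherwise; $\Delta_w(M,I)$ is the simplicial complex of all $\tau\subseteq[n]$ containing no $b_I(C)$. For $S,T\subseteq[n]$, $x_Sy_T$ denotes the set $\{x_i:i\in S\}\cup\{y_j:j\in T\}$. For $u\in\mathbb{R}^n$ with distinct coordinates (ordering $[n]$ by $i<_uj$ iff $u_i<u_j$), the external activity complex $B_u(M)$ is the simplicial complex on vertex set $\{x_i,y_i:i\in[n]\}$ whose minimal non-faces are the sets $x_{\min_{<_u}(C)}y_{C\setminus\min_{<_u}(C)}$ for $C$ a circuit of $M$. The link of a face $\sigma$ in $\Delta$ is $\{\tau\in\Delta:\tau\cup\sigma\in\Delta,\ \tau\cap\sigma=\emptyset\}$.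
   Formalization: The weights $w$ have entries in the nonnegative rationals rather than in the nonnegative reals. -}

module Defs where

open import Data.Nat using (ℕ)
open import Data.Fin using (Fin)
open import Data.Fin.Subset using (Subset; _∈_; _∉_; _⊆_; ⁅_⁆; _∩_; _∪_; _─_; ∁; ⊥)
open import Data.Vec using (lookup)
open import Data.Bool using (if_then_else_)
open import Data.Rational using (ℚ; _≤_; -_; 0ℚ)
open import Data.Product using (Σ; _×_; ∃; ∃-syntax; _,_)
open import Data.Sum using (_⊎_)
open import Relation.Nullary using (¬_)
open import Relation.Binary.PropositionalEquality using (_≡_; _≢_)
open import Function.Bundles using (_⇔_)

record Matroid (n : ℕ) : Set₁ where
  field
    Circuit       : Subset n → Set
    empty-not     : ¬ Circuit ⊥
    incomparable  : ∀ {C D} → Circuit C → Circuit D → C ⊆ D → C ≡ D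
    elimination   : ∀ {C D e} → Circuit C → Circuit D → C ≢ D → e ∈ C → e ∈ D →
                    ∃[ F ] (Circuit F × F ⊆ ((C ∪ D) ─ ⁅ e ⁆))
open Matroid public

Loop : ∀ {n} → Matroid n → Fin n → Set
Loop M i = Circuit M ⁅ i ⁆

IsMin : ∀ {n} → (Fin n → ℚ) → Subset n → Fin n → Set
IsMin v S m = m ∈ S × (∀ j → j ∈ S → v m ≤ v j)

IsMax : ∀ {n} → (Fin n → ℚ) → Subset n → Fin n → Set
IsMax v S m = m ∈ S × (∀ j → j ∈ S → v j ≤ v m)

-- B is b_I(C) (relational form of the function b_I, w-ordering)
IsBroken : ∀ {n} → (Fin n → ℚ) → Subset n → Subset n → Subset n → Set
IsBroken w I C B =
  (C ⊆ I × ∃[ m ] (IsMin w C m × B ≡ C ─ ⁅ m ⁆))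
  ⊎ (¬ (C ⊆ I) × ∃[ m ] (IsMax w (C ─ I) m × B ≡ (C ∩ I) ∪ ⁅ m ⁆))

SemiBrokenFace : ∀ {n} → Matroid n → Subset n → (Fin n → ℚ) → Subset n → Set
SemiBrokenFace M I w τ = ∀ C B → Circuit M C → IsBroken w I C B → ¬ (B ⊆ τ)

-- A subset of the vertex set {x_i, y_i : i ∈ [n]} is a pair (X , Y) standing for x_X y_Y.
Subset₂ : ℕ → Set
Subset₂ n = Subset n × Subset n

_⊆₂_ : ∀ {n} → Subset₂ n → Subset₂ n → Set
(X , Y) ⊆₂ (X' , Y') = X ⊆ X' × Y ⊆ Y'

_∪₂_ : ∀ {n} → Subset₂ n → Subset₂ n → Subset₂ n
(X , Y) ∪₂ (X' , Y') = (X ∪ X') , (Y ∪ Y')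

_∩₂_ : ∀ {n} → Subset₂ n → Subset₂ n → Subset₂ n
(X , Y) ∩₂ (X' , Y') = (X ∩ X') , (Y ∩ Y')

ExtActFace : ∀ {n} → Matroid n → (Fin n → ℚ) → Subset₂ n → Set
ExtActFace M u ρ = ∀ C m → Circuit M C → IsMin u C m → ¬ ((⁅ m ⁆ , C ─ ⁅ m ⁆) ⊆₂ ρ)

Link : ∀ {n} → (Subset₂ n → Set) → Subset₂ n → Subset₂ n → Set
Link Δ σ τ = Δ (τ ∪₂ σ) × (τ ∩₂ σ) ≡ (⊥ , ⊥)

twist : ∀ {n} → Subset n → (Fin n → ℚ) → Fin n → ℚ
twist I w i = if lookup I i then w i else - (w i)

vmap : ∀ {n} → Subset n → Subset n → Subset₂ n
vmap I τ = (τ ─ I) , (τ ∩ I)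

sigma : ∀ {n} → Subset n → Subset₂ n
sigma I = I , ∁ I

-- Put u = twist I w. Since w ≥ 0 and w is injective, every element of I is u-larger
-- than every element outside I, u agrees with w on I and reverses w outside I.
-- Hence the u-minimum m of a circuit C is its w-minimum when C ⊆ I, and the
-- w-maximum of C ∖ I otherwise. The minimal non-face x_m y_{C∖m} lies in
-- vmap I τ ∪ σ exactly when its part outside σ, pulled back along the vertex
-- map, lies in τ; and in both cases that pull-back is precisely b_I(C).
module Submission where

open import Defs
open import Data.Nat using (ℕ)
open import Data.Fin using (Fin; zero; suc)
open import Data.Fin.Subset using (Subset; inside; outside; _∈_; _∉_; _⊆_; ⁅_⁆; _∩_; _∪_; _─_; ∁; ⊥; Empty)
open import Data.Fin.Subset.Properties
  using ( _∈?_; nonempty?; ∉⊥; x∈⁅x⁆; x∈⁅y⁆⇒x≡y; ⊆-antisym; Empty-unique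
        ; x∈∁p⇒x∉p; x∉p⇒x∈∁p; x∈p∩q⁺; x∈p∩q⁻; p∩q⊆p; x∈p∪q⁺; x∈p∪q⁻
        ; x∈p∧x∉q⇒x∈p─q; p─q⊆p )
open import Data.Vec using (_∷_; here; there; lookup)
open import Data.Vec.Properties using ([]=⇒lookup; lookup⇒[]=)
open import Data.Bool using (true; false)
open import Data.Rational using (ℚ; _≤_; -_; 0ℚ)
open import Data.Rational.Properties using (≤-trans; ≤-antisym; neg-antimono-≤; +-0-group)
open import Algebra.Properties.Group +-0-group using (⁻¹-involutive)
open import Data.Product using (_×_; _,_; proj₁; proj₂; ∃-syntax)
open import Data.Sum using (inj₁; inj₂; [_,_]′)
open import Relation.Nullary using (¬_; yes; no; contradiction)
open import Relation.Binary.PropositionalEquality using (_≡_; refl; sym; trans; cong; cong₂; subst; subst₂)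
open import Function.Base using (_∘_)
open import Function.Definitions using (Injective)
open import Function.Bundles using (_⇔_; mk⇔; Equivalence)
open import Function.Construct.Composition using (_⇔-∘_)
open import Function.Construct.Symmetry using (⇔-sym)
open import Data.Product.Function.NonDependent.Propositional using (_×-⇔_)

private
  variable
    n : ℕ
    x m j : Fin n
    p q : Subset n

x∈p─q⇒x∉q : ∀ (p q : Subset n) → x ∈ p ─ q → x ∉ q
x∈p─q⇒x∉q {x = zero}  (_ ∷ p) (inside  ∷ q) ()        here
x∈p─q⇒x∉q {x = zero}  (_ ∷ p) (outside ∷ q) _         ()
x∈p─q⇒x∉q {x = suc _} (_ ∷ p) (_       ∷ q) (there h) (there h') = x∈p─q⇒x∉q p q h h'

∩≡⊥⇒∉ : p ∩ q ≡ ⊥ → x ∈ p → x ∉ q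
∩≡⊥⇒∉ p∩q≡⊥ x∈p x∈q = ∉⊥ (subst (_ ∈_) p∩q≡⊥ (x∈p∩q⁺ (x∈p , x∈q)))

Empty─⇒⊆ : Empty (p ─ q) → p ⊆ q
Empty─⇒⊆ {q = q} p─q-empty {x} x∈p with x ∈? q
... | yes x∈q = x∈q
... | no  x∉q = contradiction (x , x∈p∧x∉q⇒x∈p─q x∈p x∉q) p─q-empty

∪-⊆⇔ : ∀ (p q r : Subset n) → p ∪ q ⊆ r ⇔ (p ⊆ r × q ⊆ r)
∪-⊆⇔ p q r = mk⇔ to from
  where
  to : p ∪ q ⊆ r → p ⊆ r × q ⊆ r
  to h = (λ x∈p → h (x∈p∪q⁺ (inj₁ x∈p))) , (λ x∈q → h (x∈p∪q⁺ (inj₂ x∈q)))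
  from : p ⊆ r × q ⊆ r → p ∪ q ⊆ r
  from (p⊆r , q⊆r) x∈p∪q = [ p⊆r , q⊆r ]′ (x∈p∪q⁻ p q x∈p∪q)

⊆─∪⇔─⊆ : ∀ (p q r : Subset n) → p ⊆ (r ─ q) ∪ q ⇔ p ─ q ⊆ r
⊆─∪⇔─⊆ p q r = mk⇔ to from
  where
  to : p ⊆ (r ─ q) ∪ q → p ─ q ⊆ r
  to h x∈p─q with x∈p∪q⁻ (r ─ q) q (h (p─q⊆p p q x∈p─q))
  ... | inj₁ x∈r─q = p─q⊆p r q x∈r─q
  ... | inj₂ x∈q   = contradiction x∈q (x∈p─q⇒x∉q p q x∈p─q)
  from : p ─ q ⊆ r → p ⊆ (r ─ q) ∪ q
  from h {x} x∈p with x ∈? q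
  ... | yes x∈q = x∈p∪q⁺ (inj₂ x∈q)
  ... | no  x∉q = x∈p∪q⁺ (inj₁ (x∈p∧x∉q⇒x∈p─q (h (x∈p∧x∉q⇒x∈p─q x∈p x∉q)) x∉q))

⊆∩∪∁⇔∩⊆ : ∀ (p q r : Subset n) → p ⊆ (r ∩ q) ∪ ∁ q ⇔ p ∩ q ⊆ r
⊆∩∪∁⇔∩⊆ p q r = mk⇔ to from
  where
  to : p ⊆ (r ∩ q) ∪ ∁ q → p ∩ q ⊆ r
  to h x∈p∩q with x∈p∩q⁻ p q x∈p∩q
  ... | x∈p , x∈q with x∈p∪q⁻ (r ∩ q) (∁ q) (h x∈p)
  ... | inj₁ x∈r∩q = p∩q⊆p r q x∈r∩q
  ... | inj₂ x∈∁q  = contradiction x∈q (x∈∁p⇒x∉p x∈∁q)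
  from : p ∩ q ⊆ r → p ⊆ (r ∩ q) ∪ ∁ q
  from h {x} x∈p with x ∈? q
  ... | yes x∈q = x∈p∪q⁺ (inj₁ (x∈p∩q⁺ (h (x∈p∩q⁺ (x∈p , x∈q)) , x∈q)))
  ... | no  x∉q = x∈p∪q⁺ (inj₂ (x∉p⇒x∈∁p x∉q))

neg-cancel-≤ : ∀ {a b : ℚ} → - a ≤ - b → b ≤ a
neg-cancel-≤ {a} {b} -a≤-b = subst₂ _≤_ (⁻¹-involutive b) (⁻¹-involutive a) (neg-antimono-≤ -a≤-b)

nonneg-≤-neg⇒≡0 : ∀ {a b : ℚ} → 0ℚ ≤ a → 0ℚ ≤ b → a ≤ - b → a ≡ 0ℚ × b ≡ 0ℚ
nonneg-≤-neg⇒≡0 0≤a 0≤b a≤-b =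
    ≤-antisym (≤-trans a≤-b (neg-antimono-≤ 0≤b)) 0≤a
  , ≤-antisym (neg-cancel-≤ (≤-trans 0≤a a≤-b)) 0≤b

IsMin-cong : ∀ {v v′ : Fin n → ℚ} {S : Subset n} →
             (∀ {i} → i ∈ S → v i ≡ v′ i) → IsMin v S m → IsMin v′ S m
IsMin-cong v≗v′ (m∈S , min) = m∈S , λ j j∈S → subst₂ _≤_ (v≗v′ m∈S) (v≗v′ j∈S) (min j j∈S)

module _ {I : Subset n} {w : Fin n → ℚ} where

  twist-∈ : x ∈ I → twist I w x ≡ w x
  twist-∈ x∈I rewrite []=⇒lookup x∈I = refl

  twist-∉ : x ∉ I → twist I w x ≡ - w x
  twist-∉ {x} x∉I with lookup I x in eq
  ... | true  = contradiction (lookup⇒[]= x I eq) x∉I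
  ... | false = refl

  IsMin-twist⇔IsMin : ∀ {C} → C ⊆ I → IsMin (twist I w) C m ⇔ IsMin w C m
  IsMin-twist⇔IsMin C⊆I = mk⇔ (IsMin-cong λ i∈C → twist-∈ (C⊆I i∈C))
                              (IsMin-cong λ i∈C → sym (twist-∈ (C⊆I i∈C)))

  module _ (w≥0 : ∀ i → 0ℚ ≤ w i) where

    twist-∉≤twist-∈ : j ∉ I → x ∈ I → twist I w j ≤ twist I w x
    twist-∉≤twist-∈ {j} {x} j∉I x∈I rewrite twist-∉ j∉I | twist-∈ x∈I =
      ≤-trans (neg-antimono-≤ (w≥0 j)) (w≥0 x)

    twist-∈≰twist-∉ : Injective _≡_ _≡_ w → x ∈ I → j ∉ I → ¬ (twist I w x ≤ twist I w j)
    twist-∈≰twist-∉ {x} {j} w-inj x∈I j∉I ux≤uj = j∉I (subst (_∈ I) x≡j x∈I)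
      where
      wx≡0×wj≡0 : w x ≡ 0ℚ × w j ≡ 0ℚ
      wx≡0×wj≡0 = nonneg-≤-neg⇒≡0 (w≥0 x) (w≥0 j) (subst₂ _≤_ (twist-∈ x∈I) (twist-∉ j∉I) ux≤uj)
      x≡j : x ≡ j
      x≡j = w-inj (trans (proj₁ wx≡0×wj≡0) (sym (proj₂ wx≡0×wj≡0)))

    IsMin-twist⇒∉ : ∀ {C} → Injective _≡_ _≡_ w → IsMin (twist I w) C m → j ∈ C → j ∉ I → m ∉ I
    IsMin-twist⇒∉ w-inj (_ , min) j∈C j∉I m∈I = twist-∈≰twist-∉ w-inj m∈I j∉I (min _ j∈C)

    IsMin-twist⇔IsMax─ : ∀ C → m ∉ I → IsMin (twist I w) C m ⇔ IsMax w (C ─ I) m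
    IsMin-twist⇔IsMax─ {m} C m∉I = mk⇔ to from
      where
      to : IsMin (twist I w) C m → IsMax w (C ─ I) m
      to (m∈C , min) = x∈p∧x∉q⇒x∈p─q m∈C m∉I , λ k k∈C─I →
        neg-cancel-≤ (subst₂ _≤_ (twist-∉ m∉I) (twist-∉ (x∈p─q⇒x∉q C I k∈C─I))
                                 (min k (p─q⊆p C I k∈C─I)))
      from : IsMax w (C ─ I) m → IsMin (twist I w) C m
      from (m∈C─I , max) = p─q⊆p C I m∈C─I , min
        where
        min : ∀ k → k ∈ C → twist I w m ≤ twist I w k
        min k k∈C with k ∈? I
        ... | yes k∈I = twist-∉≤twist-∈ m∉I k∈I
        ... | no  k∉I = subst₂ _≤_ (sym (twist-∉ m∉I)) (sym (twist-∉ k∉I))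
                          (neg-antimono-≤ (max k (x∈p∧x∉q⇒x∈p─q k∈C k∉I)))

vmap⁻¹ : Subset n → Subset₂ n → Subset n
vmap⁻¹ I (X , Y) = (X ─ I) ∪ (Y ∩ I)

vmap∩₂sigma≡∅ : ∀ (I τ : Subset n) → vmap I τ ∩₂ sigma I ≡ (⊥ , ⊥)
vmap∩₂sigma≡∅ I τ = cong₂ _,_ (Empty-unique x-disjoint) (Empty-unique y-disjoint)
  where
  x-disjoint : Empty ((τ ─ I) ∩ I)
  x-disjoint (_ , h) with x∈p∩q⁻ (τ ─ I) I h
  ... | x∈τ─I , x∈I = x∈p─q⇒x∉q τ I x∈τ─I x∈I
  y-disjoint : Empty ((τ ∩ I) ∩ ∁ I)
  y-disjoint (_ , h) with x∈p∩q⁻ (τ ∩ I) (∁ I) h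
  ... | x∈τ∩I , x∈∁I = x∈∁p⇒x∉p x∈∁I (proj₂ (x∈p∩q⁻ τ I x∈τ∩I))

vmap-vmap⁻¹ : ∀ (I : Subset n) ρ → ρ ∩₂ sigma I ≡ (⊥ , ⊥) → vmap I (vmap⁻¹ I ρ) ≡ ρ
vmap-vmap⁻¹ I (X , Y) ρ∩₂σ≡∅ = cong₂ _,_ (⊆-antisym x-to x-from) (⊆-antisym y-to y-from)
  where
  X∩I≡⊥ : X ∩ I ≡ ⊥
  X∩I≡⊥ = cong proj₁ ρ∩₂σ≡∅
  Y∩∁I≡⊥ : Y ∩ ∁ I ≡ ⊥
  Y∩∁I≡⊥ = cong proj₂ ρ∩₂σ≡∅
  x-to : vmap⁻¹ I (X , Y) ─ I ⊆ X
  x-to h with x∈p∪q⁻ (X ─ I) (Y ∩ I) (p─q⊆p _ I h)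
  ... | inj₁ x∈X─I = p─q⊆p X I x∈X─I
  ... | inj₂ x∈Y∩I = contradiction (proj₂ (x∈p∩q⁻ Y I x∈Y∩I)) (x∈p─q⇒x∉q _ I h)
  x-from : X ⊆ vmap⁻¹ I (X , Y) ─ I
  x-from x∈X = x∈p∧x∉q⇒x∈p─q (x∈p∪q⁺ (inj₁ (x∈p∧x∉q⇒x∈p─q x∈X x∉I))) x∉I
    where x∉I = ∩≡⊥⇒∉ X∩I≡⊥ x∈X
  y-to : vmap⁻¹ I (X , Y) ∩ I ⊆ Y
  y-to h with x∈p∩q⁻ _ I h
  ... | x∈vmap⁻¹ , x∈I with x∈p∪q⁻ (X ─ I) (Y ∩ I) x∈vmap⁻¹
  ... | inj₁ x∈X─I = contradiction x∈I (x∈p─q⇒x∉q X I x∈X─I)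
  ... | inj₂ x∈Y∩I = p∩q⊆p Y I x∈Y∩I
  y-from : Y ⊆ vmap⁻¹ I (X , Y) ∩ I
  y-from {x} x∈Y with x ∈? I
  ... | yes x∈I = x∈p∩q⁺ (x∈p∪q⁺ (inj₂ (x∈p∩q⁺ (x∈Y , x∈I))) , x∈I)
  ... | no  x∉I = contradiction (x∉p⇒x∈∁p x∉I) (∩≡⊥⇒∉ Y∩∁I≡⊥ x∈Y)

⊆₂-vmap∪₂sigma⇔ : ∀ (I τ : Subset n) ρ → ρ ⊆₂ (vmap I τ ∪₂ sigma I) ⇔ vmap⁻¹ I ρ ⊆ τ
⊆₂-vmap∪₂sigma⇔ I τ (X , Y) =
  ⇔-sym (∪-⊆⇔ (X ─ I) (Y ∩ I) τ) ⇔-∘ (⊆─∪⇔─⊆ X I τ ×-⇔ ⊆∩∪∁⇔∩⊆ Y I τ)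

module _ {I C : Subset n} {m : Fin n} where

  vmap⁻¹-nonFace-⊆ : C ⊆ I → m ∈ I → vmap⁻¹ I (⁅ m ⁆ , C ─ ⁅ m ⁆) ≡ C ─ ⁅ m ⁆
  vmap⁻¹-nonFace-⊆ C⊆I m∈I = ⊆-antisym to from
    where
    to : vmap⁻¹ I (⁅ m ⁆ , C ─ ⁅ m ⁆) ⊆ C ─ ⁅ m ⁆
    to h with x∈p∪q⁻ (⁅ m ⁆ ─ I) ((C ─ ⁅ m ⁆) ∩ I) h
    ... | inj₁ x∈⁅m⁆─I = contradiction (subst (_∈ I) (sym x≡m) m∈I) (x∈p─q⇒x∉q ⁅ m ⁆ I x∈⁅m⁆─I)
      where x≡m = x∈⁅y⁆⇒x≡y m (p─q⊆p ⁅ m ⁆ I x∈⁅m⁆─I)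
    ... | inj₂ x∈C─m∩I = p∩q⊆p (C ─ ⁅ m ⁆) I x∈C─m∩I
    from : C ─ ⁅ m ⁆ ⊆ vmap⁻¹ I (⁅ m ⁆ , C ─ ⁅ m ⁆)
    from x∈C─m = x∈p∪q⁺ (inj₂ (x∈p∩q⁺ (x∈C─m , C⊆I (p─q⊆p C ⁅ m ⁆ x∈C─m))))

  vmap⁻¹-nonFace-∉ : m ∉ I → vmap⁻¹ I (⁅ m ⁆ , C ─ ⁅ m ⁆) ≡ (C ∩ I) ∪ ⁅ m ⁆
  vmap⁻¹-nonFace-∉ m∉I = ⊆-antisym to from
    where
    ∈⁅m⁆⇒∉I : x ∈ ⁅ m ⁆ → x ∉ I
    ∈⁅m⁆⇒∉I x∈⁅m⁆ x∈I = m∉I (subst (_∈ I) (x∈⁅y⁆⇒x≡y m x∈⁅m⁆) x∈I)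
    to : vmap⁻¹ I (⁅ m ⁆ , C ─ ⁅ m ⁆) ⊆ (C ∩ I) ∪ ⁅ m ⁆
    to h with x∈p∪q⁻ (⁅ m ⁆ ─ I) ((C ─ ⁅ m ⁆) ∩ I) h
    ... | inj₁ x∈⁅m⁆─I = x∈p∪q⁺ (inj₂ (p─q⊆p ⁅ m ⁆ I x∈⁅m⁆─I))
    ... | inj₂ x∈C─m∩I with x∈p∩q⁻ (C ─ ⁅ m ⁆) I x∈C─m∩I
    ...   | x∈C─m , x∈I = x∈p∪q⁺ (inj₁ (x∈p∩q⁺ (p─q⊆p C ⁅ m ⁆ x∈C─m , x∈I)))
    from : (C ∩ I) ∪ ⁅ m ⁆ ⊆ vmap⁻¹ I (⁅ m ⁆ , C ─ ⁅ m ⁆)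
    from h = x∈p∪q⁺ ([ inj₂ ∘ from-C∩I , inj₁ ∘ from-⁅m⁆ ]′ (x∈p∪q⁻ (C ∩ I) ⁅ m ⁆ h))
      where
      from-C∩I : x ∈ C ∩ I → x ∈ (C ─ ⁅ m ⁆) ∩ I
      from-C∩I x∈C∩I with x∈p∩q⁻ C I x∈C∩I
      ... | x∈C , x∈I = x∈p∩q⁺ (x∈p∧x∉q⇒x∈p─q x∈C (λ x∈⁅m⁆ → ∈⁅m⁆⇒∉I x∈⁅m⁆ x∈I) , x∈I)
      from-⁅m⁆ : x ∈ ⁅ m ⁆ → x ∈ ⁅ m ⁆ ─ I
      from-⁅m⁆ x∈⁅m⁆ = x∈p∧x∉q⇒x∈p─q x∈⁅m⁆ (∈⁅m⁆⇒∉I x∈⁅m⁆)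

module _ {I : Subset n} {w : Fin n → ℚ} (w≥0 : ∀ i → 0ℚ ≤ w i) where

  IsMin-twist⇒IsBroken : ∀ {C} → Injective _≡_ _≡_ w → IsMin (twist I w) C m →
                         IsBroken w I C (vmap⁻¹ I (⁅ m ⁆ , C ─ ⁅ m ⁆))
  IsMin-twist⇒IsBroken {m} {C} w-inj min with nonempty? (C ─ I)
  ... | no C─I-empty = inj₁ (C⊆I , m , Equivalence.to (IsMin-twist⇔IsMin C⊆I) min
                                   , vmap⁻¹-nonFace-⊆ C⊆I (C⊆I (proj₁ min)))
    where C⊆I = Empty─⇒⊆ C─I-empty
  ... | yes (j , j∈C─I) = inj₂ (C⊈I , m , Equivalence.to (IsMin-twist⇔IsMax─ w≥0 C m∉I) min
                                      , vmap⁻¹-nonFace-∉ m∉I)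
    where
    j∉I = x∈p─q⇒x∉q C I j∈C─I
    C⊈I : ¬ (C ⊆ I)
    C⊈I C⊆I = j∉I (C⊆I (p─q⊆p C I j∈C─I))
    m∉I = IsMin-twist⇒∉ w≥0 w-inj min (p─q⊆p C I j∈C─I) j∉I

  IsBroken⇒IsMin-twist : ∀ {C B} → IsBroken w I C B →
                         ∃[ m ] (IsMin (twist I w) C m × B ≡ vmap⁻¹ I (⁅ m ⁆ , C ─ ⁅ m ⁆))
  IsBroken⇒IsMin-twist (inj₁ (C⊆I , m , min , refl)) =
    m , Equivalence.from (IsMin-twist⇔IsMin C⊆I) min , sym (vmap⁻¹-nonFace-⊆ C⊆I (C⊆I (proj₁ min)))
  IsBroken⇒IsMin-twist {C} (inj₂ (_ , m , max , refl)) =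
    m , Equivalence.from (IsMin-twist⇔IsMax─ w≥0 C m∉I) max , sym (vmap⁻¹-nonFace-∉ m∉I)
    where m∉I = x∈p─q⇒x∉q C I (proj₁ max)

  module _ (w-inj : Injective _≡_ _≡_ w) (M : Matroid n) where

    sigma-isFace : (∀ i → i ∈ I → ¬ Loop M i) → ExtActFace M (twist I w) (sigma I)
    sigma-isFace noLoops C m C-circuit min (⁅m⁆⊆I , C─m⊆∁I) with nonempty? (C ─ ⁅ m ⁆)
    ... | yes (j , j∈C─m) =
      IsMin-twist⇒∉ w≥0 w-inj min (p─q⊆p C ⁅ m ⁆ j∈C─m) (x∈∁p⇒x∉p (C─m⊆∁I j∈C─m)) (⁅m⁆⊆I (x∈⁅x⁆ m))
    ... | no C─m-empty = noLoops m (⁅m⁆⊆I (x∈⁅x⁆ m)) (subst (Circuit M) C≡⁅m⁆ C-circuit)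
      where
      C≡⁅m⁆ : C ≡ ⁅ m ⁆
      C≡⁅m⁆ = ⊆-antisym (Empty─⇒⊆ C─m-empty)
                        (λ x∈⁅m⁆ → subst (_∈ C) (sym (x∈⁅y⁆⇒x≡y m x∈⁅m⁆)) (proj₁ min))

    SemiBrokenFace⇔ExtActFace : ∀ τ → SemiBrokenFace M I w τ ⇔
                                      ExtActFace M (twist I w) (vmap I τ ∪₂ sigma I)
    SemiBrokenFace⇔ExtActFace τ = mk⇔ to from
      where
      to : SemiBrokenFace M I w τ → ExtActFace M (twist I w) (vmap I τ ∪₂ sigma I)
      to face C m C-circuit min nonFace⊆ = face C _ C-circuit (IsMin-twist⇒IsBroken w-inj min)
                                                 (Equivalence.to (⊆₂-vmap∪₂sigma⇔ I τ _) nonFace⊆)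
      from : ExtActFace M (twist I w) (vmap I τ ∪₂ sigma I) → SemiBrokenFace M I w τ
      from face C B C-circuit broken B⊆τ with IsBroken⇒IsMin-twist broken
      ... | m , min , refl = face C m C-circuit min (Equivalence.from (⊆₂-vmap∪₂sigma⇔ I τ _) B⊆τ)

proposition3p5 : (n : ℕ) (M : Matroid n) (I : Subset n) (w : Fin n → ℚ) →
    (∀ i → 0ℚ ≤ w i) → Injective _≡_ _≡_ w →
    (∀ i → i ∈ I → ¬ Loop M i) →
    ExtActFace M (twist I w) (sigma I)
    × (∀ τ → SemiBrokenFace M I w τ ⇔ Link (ExtActFace M (twist I w)) (sigma I) (vmap I τ))
    × (∀ ρ → Link (ExtActFace M (twist I w)) (sigma I) ρ → ∃[ τ ] (vmap I τ ≡ ρ))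
proposition3p5 _ M I w w≥0 w-inj noLoops =
    sigma-isFace w≥0 w-inj M noLoops
  , (λ τ → mk⇔ (λ face → to (SemiBrokenFace⇔ExtActFace w≥0 w-inj M τ) face , vmap∩₂sigma≡∅ I τ)
               (λ (face , _) → from (SemiBrokenFace⇔ExtActFace w≥0 w-inj M τ) face))
  , λ ρ (_ , ρ∩₂σ≡∅) → vmap⁻¹ I ρ , vmap-vmap⁻¹ I ρ ρ∩₂σ≡∅
  where open Equivalence
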